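{- A $\mathsf{DHHF}(t;k,(v_1,\dots,v_t),t,p)$ is fractal if and only if, for every $\ell$ with $1\le\ell\le t$, every partition of every set of $\ell$ of its columns into $\min(p,\ell)$ classes is separated by at least $t+1-\ell$ rows.
   Context: An $\mathsf{HHF}(N;k,(w_1,\dots,w_N))$ is an $N\times k$ array in which row $i$ contains at most $w_i$ distinct symbols. Given a set $S$ of columns and a partition of $S$ into $p$ classes (some possibly empty), a row $r$ separates it if any two columns in distinct classes have distinct entries in row $r$. A $\mathsf{DHHF}(N;k,(w_1,\dots,w_N),t,p)$ is an $\mathsf{HHF}(N;k,(w_1,\dots,w_N))$ in which every partition of every $t$-set of columns into $p$ classes is separated by some row. A $\mathsf{DHHF}(t;k,(v_1,\dots,v_t),t,p)$ is fractal if $t\le 2$, or if for each row $j$, deleting row $j$ yields a fractal $\mathsf{DHHF}(t-1;k,(v_1,\dots,v_{j-1},v_{j+1},\dots,v_t),t-1,\min(p,t-1))$. -}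

module Defs where

open import Data.Nat using (ℕ; zero; suc; _+_; _∸_; _≤_; _⊓_)
open import Data.Fin using (Fin; punchIn)
open import Data.Fin.Subset using (Subset; _∈_; ∣_∣)
open import Data.Product using (Σ; _×_)
open import Data.Sum using (_⊎_)
open import Relation.Binary.PropositionalEquality using (_≡_; _≢_)

HHF : (N k : ℕ) → (w : Fin N → ℕ) → Set
HHF N k w = (i : Fin N) → Fin k → Fin (w i)

-- Row r separates the partition of the column set S given by the class map
-- cls (classes indexed by Fin q; classes may be empty; values of cls outside
-- S are irrelevant): columns of S in distinct classes get distinct entries.
Separates : ∀ {N k w} → HHF N k w → Fin N → {q : ℕ} →
            Subset k → (Fin k → Fin q) → Set
Separates A r S cls =
  ∀ a b → a ∈ S → b ∈ S → cls a ≢ cls b → A r a ≢ A r b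

IsDHHF : ∀ {N k w} → HHF N k w → (t p : ℕ) → Set
IsDHHF {N} {k} A t p =
  (S : Subset k) → ∣ S ∣ ≡ t → (cls : Fin k → Fin p) →
  Σ (Fin N) λ r → Separates A r S cls

deleteRow : ∀ {t k w} → HHF (suc t) k w → (j : Fin (suc t)) →
            HHF t k (λ i → w (punchIn j i))
deleteRow A j i = A (punchIn j i)

Fractal : (t k : ℕ) (v : Fin t → ℕ) (p : ℕ) → HHF t k v → Set
Fractal zero    k v p A = IsDHHF A zero p
Fractal (suc t) k v p A =
  IsDHHF A (suc t) p ×
  (suc t ≤ 2 ⊎
   ((j : Fin (suc t)) →
      Fractal t k (λ i → v (punchIn j i)) (p ⊓ t) (deleteRow A j)))

SeparatedByAtLeast : ∀ {N k w} → HHF N k w → ℕ → {q : ℕ} →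
                     Subset k → (Fin k → Fin q) → Set
SeparatedByAtLeast {N} A m S cls =
  Σ (Subset N) λ R → (m ≤ ∣ R ∣) × (∀ r → r ∈ R → Separates A r S cls)

-- Deleting a row costs a partition at most one separating row, so the
-- separation bounds t + 1 − ℓ pass to every one-row deletion with t − ℓ, and
-- fractality follows by induction on t. Conversely, for 2 ≤ ℓ < t the array with
-- row 0 deleted is fractal, so some row r ≠ 0 separates; by induction the array
-- with row r deleted has t − ℓ separating rows, and r is one more. For ℓ = 1
-- there is at most one class, so every row separates, and ℓ = t is the DHHF
-- property itself.
module Submission where

open import Defs
open import Data.Nat using (ℕ; zero; suc; _+_; _∸_; _≤_; _⊓_; z≤n; s≤s; s≤s⁻¹; _≤?_)
open import Data.Nat.Properties
  using (≤-refl; ≤-trans; ≤-reflexive; n≤1+n; m≤n⇒m≤1+n; m≤n⇒m≤n+o; m≤n⇒m<n∨m≡n; <⇒≱; ≰⇒>;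
         m⊓n≤m; m⊓n≤n; ⊓-glb; ⊓-assoc; m≥n⇒m⊓n≡n; +-comm; +-∸-comm; +-∸-assoc;
         m+n∸n≡m; m+n∸m≡n)
open import Data.Fin as Fin using (Fin; punchIn; punchOut; inject≤)
open import Data.Fin.Properties
  using (inject≤-injective; punchIn-punchOut; punchOut-punchIn; punchInᵢ≢i)
open import Data.Fin.Subset using (Subset; ∣_∣; _∈_; inside; outside; ⊤; ⁅_⁆; Nonempty)
open import Data.Fin.Subset.Properties
  using (∣⊤∣≡n; x∈⁅y⁆⇒x≡y; ∣⁅x⁆∣≡1; ∣⊥∣≡0; nonempty?; Empty-unique)
open import Data.Vec using (_∷_; lookup; insertAt; removeAt)
open import Data.Vec.Properties using (insertAt-punchIn; removeAt-punchOut; []=⇒lookup; lookup⇒[]=)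
open import Data.Product using (Σ; _×_; _,_)
open import Data.Sum using (_⊎_; inj₁; inj₂)
open import Function using (_∘_)
open import Function.Bundles using (_⇔_; mk⇔)
open import Relation.Nullary using (yes; no; contradiction)
open import Relation.Binary.PropositionalEquality
  using (_≡_; _≢_; refl; sym; trans; cong; subst; module ≡-Reasoning)

∣insertAt-inside∣ : ∀ {n} (R : Subset n) j → ∣ insertAt R j inside ∣ ≡ suc ∣ R ∣
∣insertAt-inside∣ R             Fin.zero    = refl
∣insertAt-inside∣ (inside ∷ R)  (Fin.suc j) = cong suc (∣insertAt-inside∣ R j)
∣insertAt-inside∣ (outside ∷ R) (Fin.suc j) = ∣insertAt-inside∣ R j

∣p∣≤1+∣removeAt∣ : ∀ {n} (R : Subset (suc n)) j → ∣ R ∣ ≤ suc ∣ removeAt R j ∣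
∣p∣≤1+∣removeAt∣ (inside ∷ R)      Fin.zero    = ≤-refl
∣p∣≤1+∣removeAt∣ (outside ∷ R)     Fin.zero    = n≤1+n _
∣p∣≤1+∣removeAt∣ (inside ∷ x ∷ R)  (Fin.suc j) = s≤s (∣p∣≤1+∣removeAt∣ (x ∷ R) j)
∣p∣≤1+∣removeAt∣ (outside ∷ x ∷ R) (Fin.suc j) = ∣p∣≤1+∣removeAt∣ (x ∷ R) j

∈-removeAt⁻ : ∀ {n} (R : Subset (suc n)) j {i} → i ∈ removeAt R j → punchIn j i ∈ R
∈-removeAt⁻ R j {i} i∈ = lookup⇒[]= (punchIn j i) R (begin
  lookup R (punchIn j i)               ≡⟨ removeAt-punchOut R j≢ ⟨
  lookup (removeAt R j) (punchOut j≢)  ≡⟨ cong (lookup (removeAt R j)) (punchOut-punchIn j) ⟩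
  lookup (removeAt R j) i              ≡⟨ []=⇒lookup i∈ ⟩
  inside                               ∎)
  where
  open ≡-Reasoning
  j≢ : j ≢ punchIn j i
  j≢ = punchInᵢ≢i j i ∘ sym

∈-insertAt⁻ : ∀ {n} (R : Subset n) j {r} → r ∈ insertAt R j inside →
              r ≡ j ⊎ Σ (Fin n) λ i → i ∈ R × punchIn j i ≡ r
∈-insertAt⁻ R j {r} r∈ with r Fin.≟ j
... | yes r≡j = inj₁ r≡j
... | no  r≢j = inj₂ (punchOut j≢r , lookup⇒[]= _ R (begin
  lookup R (punchOut j≢r)                                ≡⟨ insertAt-punchIn R j inside _ ⟨
  lookup (insertAt R j inside) (punchIn j (punchOut j≢r)) ≡⟨ cong (lookup (insertAt R j inside)) (punchIn-punchOut j≢r) ⟩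
  lookup (insertAt R j inside) r                          ≡⟨ []=⇒lookup r∈ ⟩
  inside                                                  ∎) , punchIn-punchOut j≢r)
  where
  open ≡-Reasoning
  j≢r : j ≢ r
  j≢r = r≢j ∘ sym

∣p∣>0⇒Nonempty : ∀ {n} (p : Subset n) → 1 ≤ ∣ p ∣ → Nonempty p
∣p∣>0⇒Nonempty {n} p 1≤∣p∣ with nonempty? p
... | yes p≢∅ = p≢∅
... | no  p≡∅ = contradiction (subst (1 ≤_) (trans (cong ∣_∣ (Empty-unique p≡∅)) (∣⊥∣≡0 n)) 1≤∣p∣) λ ()

m⊓n⊓o≡m⊓o : ∀ m {n o} → o ≤ n → m ⊓ n ⊓ o ≡ m ⊓ o
m⊓n⊓o≡m⊓o m {n} {o} o≤n = trans (⊓-assoc m n o) (cong (m ⊓_) (m≥n⇒m⊓n≡n o≤n))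

t+1∸ℓ≡1+t∸ℓ : ∀ {t ℓ} → ℓ ≤ t → t + 1 ∸ ℓ ≡ suc (t ∸ ℓ)
t+1∸ℓ≡1+t∸ℓ ℓ≤t = trans (+-∸-comm 1 ℓ≤t) (+-comm _ 1)

Fin[p⊓1]-irrelevant : ∀ p (x y : Fin (p ⊓ 1)) → x ≡ y
Fin[p⊓1]-irrelevant (suc zero)    Fin.zero Fin.zero = refl
Fin[p⊓1]-irrelevant (suc (suc p)) Fin.zero Fin.zero = refl

module _ {N k} {w : Fin N → ℕ} {A : HHF N k w} {q} {S : Subset k} {cls : Fin k → Fin q} where

  separates-inject≤⁻ : ∀ {q′ r} (q≤q′ : q ≤ q′) →
                       Separates A r S (λ a → inject≤ (cls a) q≤q′) → Separates A r S cls
  separates-inject≤⁻ q≤q′ sep a b a∈S b∈S cls≢ =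
    sep a b a∈S b∈S (cls≢ ∘ inject≤-injective q≤q′ q≤q′ (cls a) (cls b))

  separatedByAtLeast-inject≤⁻ : ∀ {q′ m} (q≤q′ : q ≤ q′) →
                                SeparatedByAtLeast A m S (λ a → inject≤ (cls a) q≤q′) →
                                SeparatedByAtLeast A m S cls
  separatedByAtLeast-inject≤⁻ q≤q′ (R , m≤∣R∣ , sep) =
    R , m≤∣R∣ , λ r r∈R → separates-inject≤⁻ q≤q′ (sep r r∈R)

  separatedByAtLeast-mono : ∀ {m n} → m ≤ n → SeparatedByAtLeast A n S cls → SeparatedByAtLeast A m S cls
  separatedByAtLeast-mono m≤n (R , n≤∣R∣ , sep) = R , ≤-trans m≤n n≤∣R∣ , sep

  separatedByAtLeast-all : (∀ r → Separates A r S cls) → SeparatedByAtLeast A N S cls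
  separatedByAtLeast-all sep = ⊤ , ≤-reflexive (sym (∣⊤∣≡n N)) , λ r _ → sep r

  separates⇒separatedByAtLeast1 : ∀ {r} → Separates A r S cls → SeparatedByAtLeast A 1 S cls
  separates⇒separatedByAtLeast1 {r} sep =
    ⁅ r ⁆ , ≤-reflexive (sym (∣⁅x⁆∣≡1 r)) ,
    λ r′ r′∈ → subst (λ x → Separates A x S cls) (sym (x∈⁅y⁆⇒x≡y r r′∈)) sep

  separatedByAtLeast1⇒separates : SeparatedByAtLeast A 1 S cls → Σ (Fin N) λ r → Separates A r S cls
  separatedByAtLeast1⇒separates (R , 1≤∣R∣ , sep) with ∣p∣>0⇒Nonempty R 1≤∣R∣
  ... | r , r∈R = r , sep r r∈R

module _ {N k} {w : Fin (suc N) → ℕ} {A : HHF (suc N) k w} {q} {S : Subset k} {cls : Fin k → Fin q} where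

  separatedByAtLeast-deleteRow : ∀ {m} j → SeparatedByAtLeast A (suc m) S cls →
                                 SeparatedByAtLeast (deleteRow A j) m S cls
  separatedByAtLeast-deleteRow j (R , 1+m≤∣R∣ , sep) =
    removeAt R j , s≤s⁻¹ (≤-trans 1+m≤∣R∣ (∣p∣≤1+∣removeAt∣ R j)) ,
    λ i i∈ → sep (punchIn j i) (∈-removeAt⁻ R j i∈)

  separatedByAtLeast-insertRow : ∀ {m} j → Separates A j S cls →
                                 SeparatedByAtLeast (deleteRow A j) m S cls →
                                 SeparatedByAtLeast A (suc m) S cls
  separatedByAtLeast-insertRow j sepⱼ (R , m≤∣R∣ , sep) =
    insertAt R j inside , ≤-trans (s≤s m≤∣R∣) (≤-reflexive (sym (∣insertAt-inside∣ R j))) , sep′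
    where
    sep′ : ∀ r → r ∈ insertAt R j inside → Separates A r S cls
    sep′ r r∈ with ∈-insertAt⁻ R j r∈
    ... | inj₁ refl             = sepⱼ
    ... | inj₂ (i , i∈R , refl) = sep i i∈R

  separatedByAtLeast-fromDeletions : ∀ {m} → 1 ≤ m →
                                     (∀ j → SeparatedByAtLeast (deleteRow A j) m S cls) →
                                     SeparatedByAtLeast A (suc m) S cls
  separatedByAtLeast-fromDeletions 1≤m sepDel
    with separatedByAtLeast1⇒separates (separatedByAtLeast-mono 1≤m (sepDel Fin.zero))
  ... | i , sepᵢ = separatedByAtLeast-insertRow (Fin.suc i) sepᵢ (sepDel (Fin.suc i))

RobustlySeparating : ∀ {t k v} → HHF t k v → ℕ → Set
RobustlySeparating {t} {k} A p =
  (ℓ : ℕ) → 1 ≤ ℓ → ℓ ≤ t → (S : Subset k) → ∣ S ∣ ≡ ℓ → (cls : Fin k → Fin (p ⊓ ℓ)) →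
  SeparatedByAtLeast A (t + 1 ∸ ℓ) S cls

fractal⇒robust : ∀ t {k v p} {A : HHF t k v} → Fractal t k v p A → RobustlySeparating A p
fractal⇒robust zero _ ℓ 1≤ℓ ℓ≤0 = contradiction (≤-trans 1≤ℓ ℓ≤0) λ ()
fractal⇒robust (suc t) {p = p} _ (suc zero) _ _ S _ cls =
  separatedByAtLeast-mono (≤-reflexive (m+n∸n≡m (suc t) 1))
    (separatedByAtLeast-all λ _ a b _ _ cls≢ _ → cls≢ (Fin[p⊓1]-irrelevant p (cls a) (cls b)))
fractal⇒robust (suc t) {p = p} {A} (dhhf , deletions) ℓ@(suc (suc _)) _ ℓ≤1+t S ∣S∣≡ℓ cls
  with m≤n⇒m<n∨m≡n ℓ≤1+t
... | inj₂ refl with dhhf S ∣S∣≡ℓ (λ a → inject≤ (cls a) (m⊓n≤m p ℓ))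
...   | r , sepᵣ = separatedByAtLeast-mono (≤-reflexive (m+n∸m≡n t 1))
                     (separates⇒separatedByAtLeast1 (separates-inject≤⁻ {A = A} (m⊓n≤m p ℓ) sepᵣ))
fractal⇒robust (suc t) {p = p} {A} (dhhf , deletions) ℓ@(suc (suc _)) 1≤ℓ _ S ∣S∣≡ℓ cls
    | inj₁ (s≤s ℓ≤t) with deletions
... | inj₁ 1+t≤2   = contradiction 1+t≤2 (<⇒≱ (s≤s (≤-trans (s≤s (s≤s z≤n)) ℓ≤t)))
... | inj₂ fractal =
  separatedByAtLeast-mono (≤-reflexive (+-∸-assoc 1 (m≤n⇒m≤n+o 1 ℓ≤t)))
    (separatedByAtLeast-fromDeletions 1≤t+1∸ℓ λ j →
      separatedByAtLeast-inject≤⁻ {A = deleteRow A j} p⊓ℓ≤p⊓t⊓ℓ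
        (fractal⇒robust t (fractal j) ℓ 1≤ℓ ℓ≤t S ∣S∣≡ℓ (λ a → inject≤ (cls a) p⊓ℓ≤p⊓t⊓ℓ)))
  where
  1≤t+1∸ℓ : 1 ≤ t + 1 ∸ ℓ
  1≤t+1∸ℓ = subst (1 ≤_) (sym (t+1∸ℓ≡1+t∸ℓ ℓ≤t)) (s≤s z≤n)
  p⊓ℓ≤p⊓t⊓ℓ : p ⊓ ℓ ≤ p ⊓ t ⊓ ℓ
  p⊓ℓ≤p⊓t⊓ℓ = ≤-reflexive (sym (m⊓n⊓o≡m⊓o p ℓ≤t))

robust-deleteRow : ∀ {t k v p} {A : HHF (suc t) k v} → RobustlySeparating A p →
                   ∀ j → RobustlySeparating (deleteRow A j) (p ⊓ t)
robust-deleteRow {t} {p = p} {A} robust j ℓ 1≤ℓ ℓ≤t S ∣S∣≡ℓ cls =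
  separatedByAtLeast-inject≤⁻ {A = deleteRow A j} p⊓t⊓ℓ≤p⊓ℓ
    (separatedByAtLeast-deleteRow j
      (separatedByAtLeast-mono (≤-reflexive (sym (+-∸-assoc 1 (m≤n⇒m≤n+o 1 ℓ≤t))))
        (robust ℓ 1≤ℓ (m≤n⇒m≤1+n ℓ≤t) S ∣S∣≡ℓ (λ a → inject≤ (cls a) p⊓t⊓ℓ≤p⊓ℓ))))
  where
  p⊓t⊓ℓ≤p⊓ℓ : p ⊓ t ⊓ ℓ ≤ p ⊓ ℓ
  p⊓t⊓ℓ≤p⊓ℓ = ≤-reflexive (m⊓n⊓o≡m⊓o p ℓ≤t)

robust⇒IsDHHF : ∀ {t k v p q} {A : HHF t k v} → 1 ≤ t → q ≤ p ⊓ t →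
                RobustlySeparating A p → IsDHHF A t q
robust⇒IsDHHF {t} {A = A} 1≤t q≤p⊓t robust S ∣S∣≡t cls =
  separatedByAtLeast1⇒separates
    (separatedByAtLeast-mono (≤-reflexive (sym (m+n∸m≡n t 1)))
      (separatedByAtLeast-inject≤⁻ {A = A} q≤p⊓t
        (robust t 1≤t ≤-refl S ∣S∣≡t (λ a → inject≤ (cls a) q≤p⊓t))))

robust⇒fractal : ∀ t {k v p} {A : HHF t k v} → IsDHHF A t p → RobustlySeparating A p → Fractal t k v p A
robust⇒fractal zero    dhhf _      = dhhf
robust⇒fractal (suc t) {k} {v} {p} {A} dhhf robust = dhhf , deletions (suc t ≤? 2)
  where
  deletions : _ → suc t ≤ 2 ⊎ ((j : Fin (suc t)) → Fractal t k (v ∘ punchIn j) (p ⊓ t) (deleteRow A j))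
  deletions (yes 1+t≤2) = inj₁ 1+t≤2
  deletions (no  1+t≰2) = inj₂ λ j →
    robust⇒fractal t (robust⇒IsDHHF 1≤t (⊓-glb ≤-refl (m⊓n≤n p t)) (robust-deleteRow robust j))
                     (robust-deleteRow robust j)
    where
    1≤t : 1 ≤ t
    1≤t = ≤-trans (s≤s z≤n) (s≤s⁻¹ (≰⇒> 1+t≰2))

lemma10 : (t k : ℕ) (v : Fin t → ℕ) (p : ℕ) (A : HHF t k v) →
          IsDHHF A t p →
          (Fractal t k v p A ⇔
            ((ℓ : ℕ) → 1 ≤ ℓ → ℓ ≤ t →
              (S : Subset k) → ∣ S ∣ ≡ ℓ → (cls : Fin k → Fin (p ⊓ ℓ)) →
              SeparatedByAtLeast A (t + 1 ∸ ℓ) S cls))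
lemma10 t k v p A dhhf = mk⇔ (fractal⇒robust t) (robust⇒fractal t dhhf)
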